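{- Let $q$ be a power of an odd prime. If $A \subset \mathbb{F}_q^2$ and $|A| \geq 2q-1$, then $A$ generates all spreads. That is, for every value $\theta$ of the form $S(u,v)$ with $u,v \in \mathbb{F}_q^2$ having $\|u\|,\|v\| \neq 0$, there are $a,b,c \in A$ with $S(a-b,c-b) = \theta$.
   Context: For $a \in \mathbb{F}_q^2$, $\|a\| = a_1^2 + a_2^2$. For $a,b$ with $\|a\|,\|b\| \neq 0$, the spread is $S(a,b) = 1 - \frac{(a\cdot b)^2}{\|a\|\,\|b\|}$, where $a\cdot b = a_1b_1 + a_2b_2$. -}

module Defs where

open import Level using (0ℓ)
open import Data.Nat using (ℕ)
open import Data.Fin using (Fin)
open import Data.Product using (_×_; _,_)
open import Relation.Binary.PropositionalEquality using (_≡_; _≢_)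
open import Relation.Binary.Definitions using (DecidableEquality)
open import Algebra.Structures using (IsCommutativeRing)
open import Function.Bundles using (_↔_)

-- The inverse is made total by the (harmless) convention 0⁻¹ = 0; it is only
-- required to be a genuine inverse on nonzero elements.
record FiniteField (q : ℕ) : Set₁ where
  field
    Carrier : Set
    _+_ _*_ : Carrier → Carrier → Carrier
    -_      : Carrier → Carrier
    0# 1#   : Carrier
    _⁻¹     : Carrier → Carrier
    isCommutativeRing : IsCommutativeRing _≡_ _+_ _*_ -_ 0# 1#
    1≢0     : 1# ≢ 0#
    inverseʳ : ∀ x → x ≢ 0# → x * (x ⁻¹) ≡ 1#
    inv-0   : 0# ⁻¹ ≡ 0#
    _≟_     : DecidableEquality Carrier
    enum    : Carrier ↔ Fin q

  infixl 6 _+_ _-_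
  infixl 7 _*_

  _-_ : Carrier → Carrier → Carrier
  x - y = x + (- y)

  _/_ : Carrier → Carrier → Carrier
  x / y = x * (y ⁻¹)

  Pt : Set
  Pt = Carrier × Carrier

  _⊖_ : Pt → Pt → Pt
  (a₁ , a₂) ⊖ (b₁ , b₂) = (a₁ - b₁ , a₂ - b₂)

  _·_ : Pt → Pt → Carrier
  (a₁ , a₂) · (b₁ , b₂) = a₁ * b₁ + a₂ * b₂

  ‖_‖ : Pt → Carrier
  ‖ a ‖ = a · a

  -- spread S(a,b) = 1 - (a·b)² / (‖a‖ ‖b‖)  (meaningful when ‖a‖,‖b‖ ≠ 0)
  S : Pt → Pt → Carrier
  S a b = 1# - ((a · b) * (a · b)) / (‖ a ‖ * ‖ b ‖)

module Submission where

-- For a direction u, the lines parallel to u are the level sets of the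
-- cross product x ↦ u × x = x₁u₂ - x₂u₁, which takes at most q values.  Call
-- b ∈ A "u-partnered" if another point a ∈ A lies on the same u-line; then
-- a - b = t·u with t ≠ 0.  If b is u-partnered by a and v-partnered by c, the
-- angle (a, b, c) has spread S(t·u, s·v) = S(u,v), since the spread is
-- invariant under nonzero rescaling of either argument.
--
-- Such a b exists by counting.  The points without a u-partner sit alone on
-- their u-lines, and since |A| > q at least one u-line is shared, so there are
-- at most q - 1 of them; likewise for v.  Hence if no point were partnered in
-- both directions, |A| ≤ 2q - 2.

open import Defs
open import Data.Nat using (ℕ)
open import Data.Fin.Properties using (any?; pigeonhole; injective⇒≤; +↔⊎)
import Data.Fin.Properties as Fin
open import Data.List using (List; length; lookup)
open import Data.List.Membership.Propositional using (_∈_)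
open import Data.List.Membership.Propositional.Properties using (∈-lookup)
open import Data.List.Relation.Unary.All as All using ()
open import Data.List.Relation.Unary.AllPairs using (_∷_)
open import Data.List.Relation.Unary.Unique.Propositional using (Unique)
open import Data.Sum using (_⊎_; inj₁; inj₂)
open import Data.Sum.Properties using (inj₁-injective; inj₂-injective)
open import Data.Product using (_×_; _,_; proj₁; proj₂; ∃; ∃-syntax)
open import Data.Empty using (⊥-elim)
open import Function.Bundles using (Inverse; Injection)
open import Function.Properties.Inverse using (↔⇒↣)
open import Relation.Nullary using (¬_; Dec; yes; no; ¬?; contradiction)
open import Relation.Nullary.Decidable using (_×-dec_)
open import Relation.Binary.PropositionalEquality
open import Algebra.Bundles using (CommutativeRing)
import Algebra.Properties.Group as GroupProperties
import Algebra.Properties.AbelianGroup as AbelianGroupProperties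
import Algebra.Properties.Ring as RingProperties
import Algebra.Solver.Ring.NaturalCoefficients.Default as SemiringSolver

module Plane {q : ℕ} (F : FiniteField q) where
  open FiniteField F

  commutativeRing : CommutativeRing _ _
  commutativeRing = record { isCommutativeRing = isCommutativeRing }

  open CommutativeRing commutativeRing
    using (*-comm; *-assoc; *-identityˡ; *-identityʳ; zeroˡ; zeroʳ;
           +-group; +-abelianGroup; ring; commutativeSemiring)
  open GroupProperties +-group using (x∙y⁻¹≈ε⇒x≈y; x≈y⇒x∙y⁻¹≈ε)
  open AbelianGroupProperties +-abelianGroup using (⁻¹-anti-homo‿-)
  open RingProperties ring using ([y-z]x≈yx-zx)
  open SemiringSolver commutativeSemiring
  open ≡-Reasoning

  inverseˡ : ∀ x → x ≢ 0# → x ⁻¹ * x ≡ 1#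
  inverseˡ x x≢0 = trans (*-comm (x ⁻¹) x) (inverseʳ x x≢0)

  *-nonzero : ∀ {x y} → x ≢ 0# → y ≢ 0# → x * y ≢ 0#
  *-nonzero {x} {y} x≢0 y≢0 xy≡0 = y≢0 (begin
    y                  ≡⟨ *-identityˡ y ⟨
    1# * y             ≡⟨ cong (_* y) (inverseˡ x x≢0) ⟨
    x ⁻¹ * x * y       ≡⟨ *-assoc (x ⁻¹) x y ⟩
    x ⁻¹ * (x * y)     ≡⟨ cong (x ⁻¹ *_) xy≡0 ⟩
    x ⁻¹ * 0#          ≡⟨ zeroʳ (x ⁻¹) ⟩
    0#                 ∎)

  ⁻¹-* : ∀ {x y} → x ≢ 0# → y ≢ 0# → (x * y) ⁻¹ ≡ x ⁻¹ * y ⁻¹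
  ⁻¹-* {x} {y} x≢0 y≢0 = begin
    z                                ≡⟨ *-identityʳ z ⟨
    z * 1#                           ≡⟨ cong (z *_) (sym (trans (cong₂ _*_ (inverseʳ x x≢0) (inverseʳ y y≢0)) (*-identityˡ 1#))) ⟩
    z * ((x * x ⁻¹) * (y * y ⁻¹))    ≡⟨ solve 5 (λ z x y x⁻ y⁻ → z :* ((x :* x⁻) :* (y :* y⁻)) := ((x :* y) :* z) :* (x⁻ :* y⁻)) refl z x y (x ⁻¹) (y ⁻¹) ⟩
    ((x * y) * z) * (x ⁻¹ * y ⁻¹)    ≡⟨ cong (_* (x ⁻¹ * y ⁻¹)) (inverseʳ (x * y) (*-nonzero x≢0 y≢0)) ⟩
    1# * (x ⁻¹ * y ⁻¹)               ≡⟨ *-identityˡ _ ⟩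
    x ⁻¹ * y ⁻¹                      ∎
    where z = (x * y) ⁻¹

  cancel-/ : ∀ {k y} x → k ≢ 0# → y ≢ 0# → (k * x) / (k * y) ≡ x / y
  cancel-/ {k} {y} x k≢0 y≢0 = begin
    (k * x) * (k * y) ⁻¹        ≡⟨ cong ((k * x) *_) (⁻¹-* k≢0 y≢0) ⟩
    (k * x) * (k ⁻¹ * y ⁻¹)     ≡⟨ solve 4 (λ k x k⁻ y⁻ → (k :* x) :* (k⁻ :* y⁻) := (k⁻ :* k) :* (x :* y⁻)) refl k x (k ⁻¹) (y ⁻¹) ⟩
    (k ⁻¹ * k) * (x * y ⁻¹)     ≡⟨ cong (_* (x * y ⁻¹)) (inverseˡ k k≢0) ⟩
    1# * (x * y ⁻¹)             ≡⟨ *-identityˡ _ ⟩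
    x * y ⁻¹                    ∎

  divide-out : ∀ {N x} c y → N ≢ 0# → x * N ≡ c * y → x ≡ (c / N) * y
  divide-out {N} {x} c y N≢0 e = begin
    x                     ≡⟨ *-identityʳ x ⟨
    x * 1#                ≡⟨ cong (x *_) (inverseʳ N N≢0) ⟨
    x * (N * N ⁻¹)        ≡⟨ *-assoc x N (N ⁻¹) ⟨
    (x * N) * N ⁻¹        ≡⟨ cong (_* N ⁻¹) e ⟩
    (c * y) * N ⁻¹        ≡⟨ solve 3 (λ c y N⁻ → (c :* y) :* N⁻ := (c :* N⁻) :* y) refl c y (N ⁻¹) ⟩
    (c / N) * y           ∎

  scale : Carrier → Pt → Pt
  scale t (w₁ , w₂) = (t * w₁ , t * w₂)

  norm-scale : ∀ t w → ‖ scale t w ‖ ≡ (t * t) * ‖ w ‖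
  norm-scale t (w₁ , w₂) =
    solve 3 (λ t w₁ w₂ → (t :* w₁) :* (t :* w₁) :+ (t :* w₂) :* (t :* w₂) := (t :* t) :* (w₁ :* w₁ :+ w₂ :* w₂)) refl t w₁ w₂

  dot-scale : ∀ t s u v → scale t u · scale s v ≡ (t * s) * (u · v)
  dot-scale t s (u₁ , u₂) (v₁ , v₂) =
    solve 6 (λ t s u₁ u₂ v₁ v₂ → (t :* u₁) :* (s :* v₁) :+ (t :* u₂) :* (s :* v₂) := (t :* s) :* (u₁ :* v₁ :+ u₂ :* v₂)) refl t s u₁ u₂ v₁ v₂

  scale-norm-nonzero : ∀ {t w} → t ≢ 0# → ‖ w ‖ ≢ 0# → ‖ scale t w ‖ ≢ 0#
  scale-norm-nonzero {t} {w} t≢0 w≢0 e = *-nonzero (*-nonzero t≢0 t≢0) w≢0 (trans (sym (norm-scale t w)) e)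

  spread-scale : ∀ {t s u v} → t ≢ 0# → s ≢ 0# → ‖ u ‖ ≢ 0# → ‖ v ‖ ≢ 0# →
                 S (scale t u) (scale s v) ≡ S u v
  spread-scale {t} {s} {u} {v} t≢0 s≢0 u≢0 v≢0 = cong (λ z → 1# - z) (begin
    ((scale t u · scale s v) * (scale t u · scale s v)) / (‖ scale t u ‖ * ‖ scale s v ‖)
      ≡⟨ cong₂ _/_ (cong₂ _*_ (dot-scale t s u v) (dot-scale t s u v)) (cong₂ _*_ (norm-scale t u) (norm-scale s v)) ⟩
    (((t * s) * d) * ((t * s) * d)) / (((t * t) * ‖ u ‖) * ((s * s) * ‖ v ‖))
      ≡⟨ cong₂ _/_ (solve 3 (λ t s d → ((t :* s) :* d) :* ((t :* s) :* d) := ((t :* s) :* (t :* s)) :* (d :* d)) refl t s d)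
                   (solve 4 (λ t s m n → ((t :* t) :* m) :* ((s :* s) :* n) := ((t :* s) :* (t :* s)) :* (m :* n)) refl t s ‖ u ‖ ‖ v ‖) ⟩
    (k * (d * d)) / (k * (‖ u ‖ * ‖ v ‖))
      ≡⟨ cancel-/ (d * d) (*-nonzero ts≢0 ts≢0) (*-nonzero u≢0 v≢0) ⟩
    (d * d) / (‖ u ‖ * ‖ v ‖) ∎)
    where
    d = u · v
    k = (t * s) * (t * s)
    ts≢0 = *-nonzero t≢0 s≢0

  cross : Pt → Pt → Carrier
  cross (u₁ , u₂) (w₁ , w₂) = w₁ * u₂ - w₂ * u₁

  cross-⊖ : ∀ u a b → cross u (a ⊖ b) ≡ cross u a - cross u b
  cross-⊖ (u₁ , u₂) (a₁ , a₂) (b₁ , b₂) = begin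
    (a₁ - b₁) * u₂ - (a₂ - b₂) * u₁     ≡⟨ cong₂ _-_ ([y-z]x≈yx-zx u₂ a₁ b₁) ([y-z]x≈yx-zx u₁ a₂ b₂) ⟩
    (A - B) - (C - D)                   ≡⟨ cong ((A - B) +_) (⁻¹-anti-homo‿- C D) ⟩
    (A + - B) + (D + - C)               ≡⟨ solve 4 (λ A B' C' D → (A :+ B') :+ (D :+ C') := (A :+ C') :+ (D :+ B')) refl A (- B) (- C) D ⟩
    (A + - C) + (D + - B)               ≡⟨ cong ((A - C) +_) (⁻¹-anti-homo‿- B D) ⟨
    (A - C) - (B - D)                   ∎
    where
    A = a₁ * u₂
    B = b₁ * u₂
    C = a₂ * u₁
    D = b₂ * u₁

  parallel : ∀ u w → ‖ u ‖ ≢ 0# → cross u w ≡ 0# → w ≡ scale ((w · u) / ‖ u ‖) u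
  parallel (u₁ , u₂) (w₁ , w₂) u≢0 c≡0 =
    cong₂ _,_ (divide-out (w₁ * u₁ + w₂ * u₂) u₁ u≢0 first) (divide-out (w₁ * u₁ + w₂ * u₂) u₂ u≢0 second)
    where
    collinear : w₁ * u₂ ≡ w₂ * u₁
    collinear = x∙y⁻¹≈ε⇒x≈y _ _ c≡0
    first : w₁ * (u₁ * u₁ + u₂ * u₂) ≡ (w₁ * u₁ + w₂ * u₂) * u₁
    first = begin
      w₁ * (u₁ * u₁ + u₂ * u₂)          ≡⟨ solve 3 (λ w₁ u₁ u₂ → w₁ :* (u₁ :* u₁ :+ u₂ :* u₂) := w₁ :* u₁ :* u₁ :+ (w₁ :* u₂) :* u₂) refl w₁ u₁ u₂ ⟩
      w₁ * u₁ * u₁ + (w₁ * u₂) * u₂     ≡⟨ cong (λ z → w₁ * u₁ * u₁ + z * u₂) collinear ⟩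
      w₁ * u₁ * u₁ + (w₂ * u₁) * u₂     ≡⟨ solve 4 (λ w₁ w₂ u₁ u₂ → w₁ :* u₁ :* u₁ :+ (w₂ :* u₁) :* u₂ := (w₁ :* u₁ :+ w₂ :* u₂) :* u₁) refl w₁ w₂ u₁ u₂ ⟩
      (w₁ * u₁ + w₂ * u₂) * u₁          ∎
    second : w₂ * (u₁ * u₁ + u₂ * u₂) ≡ (w₁ * u₁ + w₂ * u₂) * u₂
    second = begin
      w₂ * (u₁ * u₁ + u₂ * u₂)          ≡⟨ solve 3 (λ w₂ u₁ u₂ → w₂ :* (u₁ :* u₁ :+ u₂ :* u₂) := (w₂ :* u₁) :* u₁ :+ w₂ :* u₂ :* u₂) refl w₂ u₁ u₂ ⟩
      (w₂ * u₁) * u₁ + w₂ * u₂ * u₂     ≡⟨ cong (λ z → z * u₁ + w₂ * u₂ * u₂) collinear ⟨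
      (w₁ * u₂) * u₁ + w₂ * u₂ * u₂     ≡⟨ solve 4 (λ w₁ w₂ u₁ u₂ → (w₁ :* u₂) :* u₁ :+ w₂ :* u₂ :* u₂ := (w₁ :* u₁ :+ w₂ :* u₂) :* u₂) refl w₁ w₂ u₁ u₂ ⟩
      (w₁ * u₁ + w₂ * u₂) * u₂          ∎

  difference-along : ∀ {u a b} → ‖ u ‖ ≢ 0# → a ≢ b → cross u a ≡ cross u b →
                     ∃[ t ] (t ≢ 0# × a ⊖ b ≡ scale t u)
  difference-along {u} {a₁ , a₂} {b₁ , b₂} u≢0 a≢b same-line = t , t≢0 , a-b≡tu
    where
    w = (a₁ , a₂) ⊖ (b₁ , b₂)
    t = (w · u) / ‖ u ‖
    a-b≡tu : w ≡ scale t u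
    a-b≡tu = parallel u w u≢0 (trans (cross-⊖ u _ _) (x≈y⇒x∙y⁻¹≈ε same-line))
    t≢0 : t ≢ 0#
    t≢0 t≡0 = a≢b (cong₂ _,_ (x∙y⁻¹≈ε⇒x≈y a₁ b₁ (cong proj₁ w≡0)) (x∙y⁻¹≈ε⇒x≈y a₂ b₂ (cong proj₂ w≡0)))
      where
      w≡0 : w ≡ (0# , 0#)
      w≡0 = trans a-b≡tu (trans (cong (λ z → scale z u) t≡0) (cong₂ _,_ (zeroˡ _) (zeroˡ _)))

  spread-realised : ∀ {u v a b c} → ‖ u ‖ ≢ 0# → ‖ v ‖ ≢ 0# → a ≢ b → c ≢ b →
                    cross u a ≡ cross u b → cross v c ≡ cross v b →
                    ‖ a ⊖ b ‖ ≢ 0# × ‖ c ⊖ b ‖ ≢ 0# × S (a ⊖ b) (c ⊖ b) ≡ S u v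
  spread-realised {u} {v} {a} {b} {c} u≢0 v≢0 a≢b c≢b on-u-line on-v-line =
    realise (difference-along u≢0 a≢b on-u-line) (difference-along v≢0 c≢b on-v-line)
    where
    realise : ∃[ t ] (t ≢ 0# × a ⊖ b ≡ scale t u) → ∃[ s ] (s ≢ 0# × c ⊖ b ≡ scale s v) →
              ‖ a ⊖ b ‖ ≢ 0# × ‖ c ⊖ b ‖ ≢ 0# × S (a ⊖ b) (c ⊖ b) ≡ S u v
    realise (t , t≢0 , a-b≡tu) (s , s≢0 , c-b≡sv) =
      subst (λ x → ‖ x ‖ ≢ 0#) (sym a-b≡tu) (scale-norm-nonzero t≢0 u≢0) ,
      subst (λ x → ‖ x ‖ ≢ 0#) (sym c-b≡sv) (scale-norm-nonzero s≢0 v≢0) ,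
      trans (cong₂ S a-b≡tu c-b≡sv) (spread-scale t≢0 s≢0 u≢0 v≢0)

-- Natural-number arithmetic is opened only here: inside Plane its operators
-- would clash with those of the field.
open import Data.Nat using (zero; suc; _≤_; _^_; _∸_; _*_; _<_; _+_; s≤s; s≤s⁻¹; z≤n)
open import Data.Nat.Properties
  using (+-identityʳ; +-comm; +-monoʳ-≤; ≤-trans; ≤-reflexive; <⇒≱)
open import Data.Nat.Divisibility using (_∣_)
open import Data.Nat.Primality using (Prime)
open import Data.Fin using (Fin; zero; suc)

module Partners {n q : ℕ} where

  HasPartner : (Fin n → Fin q) → Fin n → Set
  HasPartner h i = ∃[ j ] (j ≢ i × h j ≡ h i)

  hasPartner? : (h : Fin n → Fin q) → ∀ i → Dec (HasPartner h i)
  hasPartner? h i = any? λ j → ¬? (j Fin.≟ i) ×-dec (h j Fin.≟ h i)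

  unpartnered-injective : ∀ h {i i'} → ¬ HasPartner h i → h i ≡ h i' → i ≡ i'
  unpartnered-injective h {i} {i'} lonely e with i Fin.≟ i'
  ... | yes i≡i' = i≡i'
  ... | no i≢i' = ⊥-elim (lonely (i' , ≢-sym i≢i' , sym e))

  some-partnered : q < n → ∀ h → ∃ (HasPartner h)
  some-partnered q<n h with pigeonhole q<n h
  ... | i , j , i<j , e = i , j , ≢-sym (Fin.<⇒≢ i<j) , sym e

  -- Otherwise index i is sent to the f-value of i if it is f-unpartnered and
  -- to the g-value of i if not (then it is g-unpartnered); together with an
  -- f-value and a g-value of partnered indices, which this map misses, this
  -- gives an injection Fin (2 + n) → Fin q ⊎ Fin q.
  doubly-partnered : q < n → q + q < 2 + n → (f g : Fin n → Fin q) →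
                     ∃[ i ] (HasPartner f i × HasPartner g i)
  doubly-partnered q<n bound f g
    with any? (λ i → hasPartner? f i ×-dec hasPartner? g i)
  ... | yes found = found
  ... | no none = contradiction (injective⇒≤ encode-injective) (<⇒≱ bound)
    where
    g-unpartnered : ∀ {i} → HasPartner f i → ¬ HasPartner g i
    g-unpartnered {i} pf pg = none (i , pf , pg)

    classify : ∀ i → Dec (HasPartner f i) → Fin q ⊎ Fin q
    classify i (no _) = inj₁ (f i)
    classify i (yes _) = inj₂ (g i)

    classify-injective : ∀ i j di dj → classify i di ≡ classify j dj → i ≡ j
    classify-injective i j (no ¬pf) (no _) e = unpartnered-injective f ¬pf (inj₁-injective e)
    classify-injective i j (yes pf) (yes _) e = unpartnered-injective g (g-unpartnered pf) (inj₂-injective e)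

    i₀ = proj₁ (some-partnered q<n f)
    i₁ = proj₁ (some-partnered q<n g)

    misses-f : ∀ i di → classify i di ≢ inj₁ (f i₀)
    misses-f i (no ¬pf) e
      with unpartnered-injective f ¬pf (inj₁-injective e)
    ... | refl = ¬pf (proj₂ (some-partnered q<n f))

    misses-g : ∀ i di → classify i di ≢ inj₂ (g i₁)
    misses-g i (yes pf) e
      with unpartnered-injective g (g-unpartnered pf) (inj₂-injective e)
    ... | refl = g-unpartnered pf (proj₂ (some-partnered q<n g))

    extended : Fin (2 + n) → Fin q ⊎ Fin q
    extended zero = inj₁ (f i₀)
    extended (suc zero) = inj₂ (g i₁)
    extended (suc (suc i)) = classify i (hasPartner? f i)

    extended-injective : ∀ x y → extended x ≡ extended y → x ≡ y
    extended-injective zero zero e = refl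
    extended-injective (suc zero) (suc zero) e = refl
    extended-injective zero (suc (suc j)) e = ⊥-elim (misses-f j _ (sym e))
    extended-injective (suc (suc i)) zero e = ⊥-elim (misses-f i _ e)
    extended-injective (suc zero) (suc (suc j)) e = ⊥-elim (misses-g j _ (sym e))
    extended-injective (suc (suc i)) (suc zero) e = ⊥-elim (misses-g i _ e)
    extended-injective (suc (suc i)) (suc (suc j)) e =
      cong (λ k → suc (suc k)) (classify-injective i j _ _ e)

    encode : Fin (2 + n) → Fin (q + q)
    encode x = Inverse.from +↔⊎ (extended x)

    encode-injective : ∀ {x y} → encode x ≡ encode y → x ≡ y
    encode-injective {x} {y} e = extended-injective x y (begin
      extended x                           ≡⟨ Inverse.strictlyInverseˡ +↔⊎ (extended x) ⟨
      Inverse.to +↔⊎ (encode x)            ≡⟨ cong (Inverse.to +↔⊎) e ⟩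
      Inverse.to +↔⊎ (encode y)            ≡⟨ Inverse.strictlyInverseˡ +↔⊎ (extended y) ⟩
      extended y                           ∎)
      where open ≡-Reasoning

size-bounds : ∀ {q n} → 2 ≤ q → 2 * q ∸ 1 ≤ n → q < n × q + q < 2 + n
size-bounds {suc r} {n} 2≤q large = q<n , s≤s double≤
  where
  double≤ : suc r + suc r ≤ suc n
  double≤ = s≤s (≤-trans (≤-reflexive (cong (λ m → r + suc m) (sym (+-identityʳ r)))) large)
  q<n : suc r < n
  q<n = s≤s⁻¹ (≤-trans (≤-reflexive (+-comm 2 (suc r)))
                       (≤-trans (+-monoʳ-≤ (suc r) 2≤q) double≤))

distinct⇒2≤ : ∀ {q} {x y : Fin q} → x ≢ y → 2 ≤ q
distinct⇒2≤ {suc zero} {zero} {zero} x≢y = ⊥-elim (x≢y refl)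
distinct⇒2≤ {suc (suc _)} _ = s≤s (s≤s z≤n)

lookup-injective : ∀ {X : Set} {xs : List X} → Unique xs → ∀ i j → lookup xs i ≡ lookup xs j → i ≡ j
lookup-injective (_ ∷ _) zero zero _ = refl
lookup-injective (x∉xs ∷ _) zero (suc j) e = ⊥-elim (All.lookup x∉xs (∈-lookup j) e)
lookup-injective (x∉xs ∷ _) (suc i) zero e = ⊥-elim (All.lookup x∉xs (∈-lookup i) (sym e))
lookup-injective (_ ∷ unique) (suc i) (suc j) e = cong suc (lookup-injective unique i j e)

module PointSet {q : ℕ} (F : FiniteField q) (A : List (FiniteField.Pt F)) (unique : Unique A) where
  open FiniteField F using (Pt; enum)
  open Plane F using (cross)
  open Partners

  point : Fin (length A) → Pt
  point = lookup A

  -- The line parallel to u through the i-th point, coded as an element of Fin q.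
  line : Pt → Fin (length A) → Fin q
  line u i = Inverse.to enum (cross u (point i))

  partner-on-line : ∀ u {i} → HasPartner (line u) i →
                    ∃[ j ] (point j ≢ point i × cross u (point j) ≡ cross u (point i))
  partner-on-line u (j , j≢i , same-line) =
    j , (λ e → j≢i (lookup-injective unique j _ e)) , Injection.injective (↔⇒↣ enum) same-line

-- The argument works over any finite field.  The vertex b is a point partnered along both u and v.
theorem5 : (p k q : ℕ) → Prime p → ¬ (2 ∣ p) → 1 ≤ k → q ≡ p ^ k →
    (F : FiniteField q) → let open FiniteField F hiding (_*_) in
    (A : List Pt) → Unique A → 2 * q ∸ 1 ≤ length A →
    (u v : Pt) → ‖ u ‖ ≢ 0# → ‖ v ‖ ≢ 0# →
    ∃[ a ] ∃[ b ] ∃[ c ] (a ∈ A × b ∈ A × c ∈ A ×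
    ‖ a ⊖ b ‖ ≢ 0# × ‖ c ⊖ b ‖ ≢ 0# ×
    S (a ⊖ b) (c ⊖ b) ≡ S u v)
theorem5 _ _ q _ _ _ _ F A unique large u v u≢0 v≢0 =
  let open FiniteField F using (1≢0; enum)
      open PointSet F A unique
      q≥2 = distinct⇒2≤ (λ e → 1≢0 (sym (Injection.injective (↔⇒↣ enum) e)))
      (q<n , bound) = size-bounds q≥2 large
      (i , u-partnered , v-partnered) = Partners.doubly-partnered q<n bound (line u) (line v)
      (j , j≢i , same-u-line) = partner-on-line u u-partnered
      (m , m≢i , same-v-line) = partner-on-line v v-partnered
  in point j , point i , point m , ∈-lookup j , ∈-lookup i , ∈-lookup m ,
     Plane.spread-realised F u≢0 v≢0 j≢i m≢i same-u-line same-v-line
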